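{- For every positive integer $n$, every $3$-colouring of $F_n\boxtimes F_n$ has clustering at least $\left(1-\frac{1}{\sqrt{2}}\right)n$.
   Context: All graphs are finite and simple. The fan $F_n$ is the graph obtained from the path on $n$ vertices by adding one new vertex adjacent to every vertex of the path. A colouring of a graph assigns a colour to each vertex (adjacent vertices may receive the same colour); a $c$-colouring uses at most $c$ colours. A monochromatic component is a connected component of the subgraph induced by the vertices of one colour. "Every colouring has clustering at least $k$" means every such colouring has a monochromatic component with at least $k$ vertices. The strong product $G\boxtimes H$ has vertex set $V(G)\times V(H)$, with distinct $(u,v),(u',v')$ adjacent iff ($u=u'$ and $vv'\in E(H)$) or ($v=v'$ and $uu'\in E(G)$) or ($uu'\in E(G)$ and $vv'\in E(H)$). -}

module Defs where

open import Data.Nat using (ℕ; zero; suc; _+_)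
open import Data.Fin using (Fin; toℕ)
open import Data.Product using (_×_; _,_; ∃-syntax)
open import Data.Sum using (_⊎_)
open import Data.Unit using (⊤)
open import Data.Empty using (⊥)
open import Data.List using (List; length)
open import Data.List.Relation.Unary.All using (All)
open import Data.List.Relation.Unary.Unique.Propositional using (Unique)
open import Relation.Binary.PropositionalEquality using (_≡_)

-- The fan F_n: vertex set Fin (suc n); vertex zero is the apex,
-- vertex (suc i) is the i-th vertex of the path P_n (i : Fin n).
FanAdj : (n : ℕ) → Fin (suc n) → Fin (suc n) → Set
FanAdj n Fin.zero    Fin.zero    = ⊥
FanAdj n Fin.zero    (Fin.suc j) = ⊤
FanAdj n (Fin.suc i) Fin.zero    = ⊤
FanAdj n (Fin.suc i) (Fin.suc j) = (suc (toℕ i) ≡ toℕ j) ⊎ (suc (toℕ j) ≡ toℕ i)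

StrongAdj : {A B : Set} → (A → A → Set) → (B → B → Set) → A × B → A × B → Set
StrongAdj EA EB (u , v) (u' , v') =
  (u ≡ u' × EB v v') ⊎ (v ≡ v' × EA u u') ⊎ (EA u u' × EB v v')

FanSq : (n : ℕ) → Fin (suc n) × Fin (suc n) → Fin (suc n) × Fin (suc n) → Set
FanSq n = StrongAdj (FanAdj n) (FanAdj n)

data MonoWalk {V : Set} (E : V → V → Set) {C : Set} (c : V → C) : V → V → Set where
  here : ∀ {v} → MonoWalk E c v v
  step : ∀ {u v w} → E u v → c u ≡ c v → MonoWalk E c v w → MonoWalk E c u w

-- The monochromatic component of v contains (at least) the distinct
-- vertices of the list L.
InMonoComponent : {V : Set} (E : V → V → Set) {C : Set} (c : V → C) → V → List V → Set
InMonoComponent E c v L = Unique L × All (MonoWalk E c v) L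

-- Let a be the colour of the centre (apex, apex), which is adjacent to every vertex.  Each
-- (i, apex) is adjacent to all (apex, j) and to its row (i, ·); each (apex, j) to its column.
-- Suppose every monochromatic component has fewer than n/3 vertices.  If every colour other
-- than a on the first axis (·, apex) also occurred on the second axis (apex, ·), each colour
-- class of the first axis would lie in one component (of the centre, or of a vertex of that
-- colour on the second axis), so its n vertices would fall into three classes of fewer than
-- n/3 each.  Hence some colour b occurs on the first axis only and, symmetrically, some d on
-- the second axis only, and a, b, d are the three colours.  Then every cell (i, j) has the
-- colour of (i, apex) or of (apex, j), or it or one of these axis vertices has colour a;
-- double counting the n² cells against the rows, the columns and the centre's class (whose
-- axis vertices are counted n times) gives n² < n².
-- A component with ℓ ≥ n/3 vertices satisfies 2 (n ∸ ℓ)² ≤ n².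
module Submission where

open import Defs
open import Level using (Level)
open import Data.Bool.Base using (true; false; if_then_else_)
open import Data.Nat using (ℕ; zero; suc; z≤n; z<s; >-nonZero; _+_; _*_; _∸_; _^_; _<_; _≤_; _≤?_)
open import Data.Nat.Properties
  using (≤-refl; ≤-reflexive; ≤-trans; ≤-total; ≤-<-trans; <-irrefl; ≰⇒>; module ≤-Reasoning;
         m≤m+n; m≤n+m; m<n+m; m≤n*m; +-mono-≤; +-monoˡ-≤; +-monoʳ-≤; +-mono-≤-<; +-cancelˡ-≤;
         *-monoʳ-≤; *-monoˡ-≤; *-monoʳ-<; *-identityʳ; *-zeroʳ; m≤n⇒m∸n≡0; m+[n∸m]≡n; +-*-semiring)
open import Data.Nat.Tactic.RingSolver using (solve)
open import Data.Fin using (Fin; zero; suc)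
open import Data.Fin.Properties using (_≟_; any?; all?; ¬∀⟶∃¬)
open import Data.Product using (_×_; _,_; ∃-syntax)
open import Data.Sum as Sum using (_⊎_; inj₁; inj₂)
open import Data.Empty using (⊥; ⊥-elim)
open import Data.Unit using (tt)
open import Data.List using (List; []; _∷_; _++_; length; filter; tabulate; map; cartesianProduct; allFin)
open import Data.List.Properties using (filter-++; length-++; map-tabulate)
open import Data.List.Relation.Unary.All as All using (All)
import Data.List.Relation.Unary.All.Properties as All
open import Data.List.Relation.Unary.Unique.Propositional using (Unique)
import Data.List.Relation.Unary.Unique.Propositional.Properties as Unique
open import Function using (_∘_; id)
open import Relation.Nullary using (Dec; does; ¬_; yes; no)
open import Relation.Nullary.Decidable using (toWitness; ¬?; _⊎-dec_; _→-dec_)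
open import Relation.Unary using (Pred; Decidable)
open import Relation.Binary.PropositionalEquality
  using (_≡_; _≢_; refl; sym; trans; cong; cong₂; subst; ≢-sym; module ≡-Reasoning)
open import Algebra.Properties.Semiring.Sum +-*-semiring
  using (sum; sum-syntax; ∑-distrib-+; ∑-comm; sum-cong-≗; *-distribˡ-sum)

private variable
  p : Level
  A B : Set
  m k : ℕ

-- Indicator sums over Fin

𝟙 : {P : Set p} → Dec P → ℕ
𝟙 P? = if does P? then 1 else 0

P⇒1≤𝟙 : {P : Set p} (P? : Dec P) → P → 1 ≤ 𝟙 P?
P⇒1≤𝟙 (yes _) _  = ≤-refl
P⇒1≤𝟙 (no ¬p) p = ⊥-elim (¬p p)

¬P⇒𝟙≡0 : {P : Set p} (P? : Dec P) → ¬ P → 𝟙 P? ≡ 0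
¬P⇒𝟙≡0 (yes p) ¬p = ⊥-elim (¬p p)
¬P⇒𝟙≡0 (no _)  _  = refl

count : {P : Pred (Fin m) p} → Decidable P → ℕ
count {m = m} P? = ∑[ i < m ] 𝟙 (P? i)

∑-mono-≤ : {f g : Fin m → ℕ} → (∀ i → f i ≤ g i) → sum f ≤ sum g
∑-mono-≤ {zero}  _   = z≤n
∑-mono-≤ {suc m} f≤g = +-mono-≤ (f≤g zero) (∑-mono-≤ (f≤g ∘ suc))

∑-const : ∀ m k → ∑[ i < m ] k ≡ m * k
∑-const zero    k = refl
∑-const (suc m) k = cong (k +_) (∑-const m k)

∑₂-distrib-+ : (f g : Fin m → Fin k → ℕ) →
  ∑[ i < m ] ∑[ j < k ] (f i j + g i j) ≡ ∑[ i < m ] ∑[ j < k ] f i j + ∑[ i < m ] ∑[ j < k ] g i j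
∑₂-distrib-+ {m} {k} f g = trans (sum-cong-≗ {m} (λ i → ∑-distrib-+ (f i) (g i)))
  (∑-distrib-+ (λ i → ∑[ j < k ] f i j) (λ i → ∑[ j < k ] g i j))

∑-scaled-< : ∀ c {b} (f : Fin m → ℕ) → (∀ i → c * f i < b) → m + c * sum f ≤ m * b
∑-scaled-< {m} c {b} f small = begin
  m + c * sum f                         ≡⟨ cong₂ _+_ (sym (*-identityʳ m)) (*-distribˡ-sum c f) ⟩
  m * 1 + ∑[ i < m ] (c * f i)          ≡⟨ cong (_+ ∑[ i < m ] (c * f i)) (∑-const m 1) ⟨
  (∑[ i < m ] 1) + ∑[ i < m ] (c * f i) ≡⟨ ∑-distrib-+ (λ _ → 1) (λ i → c * f i) ⟨
  ∑[ i < m ] suc (c * f i)              ≤⟨ ∑-mono-≤ small ⟩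
  ∑[ i < m ] b                          ≡⟨ ∑-const m b ⟩
  m * b                                 ∎
  where open ≤-Reasoning

count-none : {P : Pred (Fin m) p} (P? : Decidable P) → (∀ i → ¬ P i) → count P? ≡ 0
count-none {m} P? ¬P = trans (sum-cong-≗ (λ i → ¬P⇒𝟙≡0 (P? i) (¬P i))) (trans (∑-const m 0) (*-zeroʳ m))

count-singleton : (y : Fin k) → count (y ≟_) ≡ 1
count-singleton {suc k} zero    = cong suc (count-none {m = k} (λ x → zero ≟ suc x) λ _ ())
count-singleton         (suc y) = count-singleton y

∑-count-fibres : (f : Fin m → Fin k) → ∑[ x < k ] count (λ i → f i ≟ x) ≡ m
∑-count-fibres {m} {k} f = begin
  ∑[ x < k ] ∑[ i < m ] 𝟙 (f i ≟ x) ≡⟨ ∑-comm (λ x i → 𝟙 (f i ≟ x)) ⟩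
  ∑[ i < m ] count (f i ≟_)         ≡⟨ sum-cong-≗ (count-singleton ∘ f) ⟩
  ∑[ i < m ] 1                      ≡⟨ ∑-const m 1 ⟩
  m * 1                             ≡⟨ *-identityʳ m ⟩
  m                                 ∎
  where open ≡-Reasoning

module _ {P : Pred A p} (P? : Decidable P) where

  length-filter-tabulate : (f : Fin m → A) → length (filter P? (tabulate f)) ≡ count (P? ∘ f)
  length-filter-tabulate {zero}  f = refl
  length-filter-tabulate {suc m} f with does (P? (f zero))
  ... | true  = cong suc (length-filter-tabulate (f ∘ suc))
  ... | false = length-filter-tabulate (f ∘ suc)

module _ {P : Pred (A × B) p} (P? : Decidable P) where

  length-filter-cartesianProduct : (f : Fin m → A) (g : Fin k → B) →
    length (filter P? (cartesianProduct (tabulate f) (tabulate g))) ≡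
    ∑[ i < m ] count (λ j → P? (f i , g j))
  length-filter-cartesianProduct {zero}  f g = refl
  length-filter-cartesianProduct {suc m} f g = begin
    length (filter P? (first ++ rest))                 ≡⟨ cong length (filter-++ P? first rest) ⟩
    length (filter P? first ++ filter P? rest)         ≡⟨ length-++ (filter P? first) ⟩
    length (filter P? first) + length (filter P? rest) ≡⟨ cong₂ _+_ first-size (length-filter-cartesianProduct (f ∘ suc) g) ⟩
    count (λ j → P? (f zero , g j)) + ∑[ i < m ] count (λ j → P? (f (suc i) , g j)) ∎
    where
    open ≡-Reasoning
    first = map (f zero ,_) (tabulate g)
    rest  = cartesianProduct (tabulate (f ∘ suc)) (tabulate g)
    first-size : length (filter P? first) ≡ count (λ j → P? (f zero , g j))
    first-size = trans (cong (length ∘ filter P?) (map-tabulate g (f zero ,_)))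
                       (length-filter-tabulate P? ((f zero ,_) ∘ g))

-- Pigeonhole and double counting

fibre-pigeonhole : (f : Fin m → Fin (suc k)) → ¬ (∀ x → suc k * count (λ i → f i ≟ x) < m)
fibre-pigeonhole {m} {k} f small = <-irrefl refl (begin-strict
  suc k * m                                            <⟨ m<n+m (suc k * m) (z<s {k}) ⟩
  suc k + suc k * m                                    ≡⟨ cong (λ t → suc k + suc k * t) (∑-count-fibres f) ⟨
  suc k + suc k * ∑[ x < suc k ] count (λ i → f i ≟ x) ≤⟨ ∑-scaled-< (suc k) _ small ⟩
  suc k * m                                            ∎)
  where open ≤-Reasoning

occupied-fibre-pigeonhole : 1 ≤ m → (f : Fin m → Fin (suc k)) →
                            ¬ (∀ i → suc k * count (λ i′ → f i′ ≟ f i) < m)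
occupied-fibre-pigeonhole {m} {k} 1≤m f small = fibre-pigeonhole f fibre-small
  where
  fibre-small : ∀ x → suc k * count (λ i → f i ≟ x) < m
  fibre-small x with any? (λ i → f i ≟ x)
  ... | yes (i , refl) = small i
  ... | no ∄i rewrite count-none (λ i → f i ≟ x) (λ i fi≡x → ∄i (i , fi≡x)) | *-zeroʳ (suc k) = 1≤m

unshared-colour : 1 ≤ m → (f g : Fin m → Fin (suc k)) (a : Fin (suc k)) →
  suc k * count (λ i → f i ≟ a) < m →
  (∀ j → suc k * count (λ i → f i ≟ g j) < m) →
  ∃[ i ] (f i ≢ a × ∀ j → g j ≢ f i)
unshared-colour {m} {k} 1≤m f g a a-small g-small
  with all? (λ i → f i ≟ a ⊎-dec any? (λ j → g j ≟ f i))
... | yes shared = ⊥-elim (occupied-fibre-pigeonhole 1≤m f (fibre-small ∘ shared))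
  where
  SmallFibre : Fin (suc k) → Set
  SmallFibre x = suc k * count (λ i → f i ≟ x) < m
  fibre-small : ∀ {i} → f i ≡ a ⊎ ∃[ j ] g j ≡ f i → SmallFibre (f i)
  fibre-small (inj₁ fi≡a)        = subst SmallFibre (sym fi≡a) a-small
  fibre-small (inj₂ (j , gj≡fi)) = subst SmallFibre gj≡fi (g-small j)
... | no ¬shared with ¬∀⟶∃¬ m _ (λ i → f i ≟ a ⊎-dec any? (λ j → g j ≟ f i)) ¬shared
... | i , ¬i-shared = i , ¬i-shared ∘ inj₁ , λ j gj≡fi → ¬i-shared (inj₂ (j , gj≡fi))

pos-+₃ : ∀ {x y z} → 1 ≤ x ⊎ 1 ≤ y ⊎ 1 ≤ z → 1 ≤ x + y + z
pos-+₃ {x} {y} {z} (inj₁ 1≤x)        = ≤-trans 1≤x (≤-trans (m≤m+n x y) (m≤m+n _ z))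
pos-+₃ {x} {y} {z} (inj₂ (inj₁ 1≤y)) = ≤-trans 1≤y (≤-trans (m≤n+m y x) (m≤m+n _ z))
pos-+₃ {x} {y} {z} (inj₂ (inj₂ 1≤z)) = ≤-trans 1≤z (m≤n+m z (x + y))

grid-not-covered : (ρ κ σ : Fin m → Fin m → ℕ) →
  (∀ i j → 1 ≤ ρ i j + κ i j + σ i j) →
  (∀ i → 3 * ∑[ j < m ] ρ i j < m) →
  (∀ j → 3 * ∑[ i < m ] κ i j < m) →
  3 * ∑[ i < m ] ∑[ j < m ] σ i j < m * m → ⊥
grid-not-covered {m} ρ κ σ cover ρ-small κ-small σ-small =
  arithmetic m (∑∑ ρ) (∑[ j < m ] ∑[ i < m ] κ i j) (∑∑ σ) covered
    (∑-scaled-< 3 _ ρ-small) (∑-scaled-< 3 _ κ-small) σ-small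
  where
  open ≤-Reasoning
  ∑∑ : (Fin m → Fin m → ℕ) → ℕ
  ∑∑ f = ∑[ i < m ] ∑[ j < m ] f i j

  covered : m * m ≤ ∑∑ ρ + ∑[ j < m ] ∑[ i < m ] κ i j + ∑∑ σ
  covered = begin
    m * m                                     ≡⟨ ∑-const m m ⟨
    ∑[ i < m ] m                              ≡⟨ sum-cong-≗ {m} (λ _ → trans (∑-const m 1) (*-identityʳ m)) ⟨
    ∑[ i < m ] ∑[ j < m ] 1                   ≤⟨ ∑-mono-≤ (λ i → ∑-mono-≤ (cover i)) ⟩
    ∑∑ (λ i j → ρ i j + κ i j + σ i j)        ≡⟨ ∑₂-distrib-+ (λ i j → ρ i j + κ i j) σ ⟩
    ∑∑ (λ i j → ρ i j + κ i j) + ∑∑ σ         ≡⟨ cong (_+ ∑∑ σ) (∑₂-distrib-+ ρ κ) ⟩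
    ∑∑ ρ + ∑∑ κ + ∑∑ σ                        ≡⟨ cong (λ t → ∑∑ ρ + t + ∑∑ σ) (∑-comm κ) ⟩
    ∑[ i < m ] ∑[ j < m ] ρ i j + ∑[ j < m ] ∑[ i < m ] κ i j + ∑∑ σ ∎

  arithmetic : ∀ m R K S → m * m ≤ R + K + S →
               m + 3 * R ≤ m * m → m + 3 * K ≤ m * m → 3 * S < m * m → ⊥
  arithmetic m R K S cov hR hK hS = <-irrefl refl (begin-strict
    3 * (m * m)                       ≤⟨ *-monoʳ-≤ 3 cov ⟩
    3 * (R + K + S)                   ≡⟨ solve (R ∷ K ∷ S ∷ []) ⟩
    3 * R + 3 * K + 3 * S             <⟨ +-mono-≤-< (+-mono-≤ (m≤n+m _ m) (m≤n+m _ m)) hS ⟩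
    (m + 3 * R) + (m + 3 * K) + m * m ≤⟨ +-monoˡ-≤ (m * m) (+-mono-≤ hR hK) ⟩
    m * m + m * m + m * m             ≡⟨ solve (m ∷ []) ⟩
    3 * (m * m)                       ∎)

weighted-sum-< : ∀ g r s → 1 ≤ m → 3 * (s + (r + g)) < m → 3 * (g + m * r + m * s) < m * m
weighted-sum-< {m} g r s 1≤m small = begin-strict
  3 * (g + m * r + m * s)     ≤⟨ *-monoʳ-≤ 3 (+-monoˡ-≤ (m * s) (+-monoˡ-≤ (m * r) (m≤n*m g m))) ⟩
  3 * (m * g + m * r + m * s) ≡⟨ solve (m ∷ g ∷ r ∷ s ∷ []) ⟩
  m * (3 * (s + (r + g)))     <⟨ *-monoʳ-< m small ⟩
  m * m                       ∎
  where
  open ≤-Reasoning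
  instance _ = >-nonZero 1≤m

three-colours : ∀ (x y z w : Fin 3) → x ≢ y → y ≢ z → x ≢ z → w ≡ x ⊎ w ≡ y ⊎ w ≡ z
three-colours = toWitness {a? = all? λ x → all? λ y → all? λ z → all? λ w →
  ¬? (x ≟ y) →-dec ¬? (y ≟ z) →-dec ¬? (x ≟ z) →-dec (w ≟ x ⊎-dec w ≟ y ⊎-dec w ≟ z)} _

∀-⊎ : {A : Set p} {B : Fin m → Set p} → (∀ i → A ⊎ B i) → A ⊎ (∀ i → B i)
∀-⊎ {m = zero}  _ = inj₂ λ ()
∀-⊎ {m = suc m} f with f zero | ∀-⊎ (f ∘ suc)
... | inj₁ x | _       = inj₁ x
... | inj₂ _ | inj₁ x  = inj₁ x
... | inj₂ y | inj₂ ys = inj₂ λ { zero → y ; (suc i) → ys i }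

twice-square-≤ : ∀ k u → u ≤ 2 * k → 2 * u ^ 2 ≤ (k + u) ^ 2
twice-square-≤ k u u≤2k = begin
  2 * (u * (u * 1))           ≡⟨ solve (u ∷ []) ⟩
  u * u + u * u               ≤⟨ +-monoʳ-≤ (u * u) (*-monoˡ-≤ u u≤2k) ⟩
  u * u + 2 * k * u           ≤⟨ m≤n+m _ (k * k) ⟩
  k * k + (u * u + 2 * k * u) ≡⟨ solve (k ∷ u ∷ []) ⟩
  (k + u) * ((k + u) * 1)     ∎
  where open ≤-Reasoning

one-third-bound : ∀ {n k} → n ≤ 3 * k → 2 * (n ∸ k) ^ 2 ≤ n ^ 2
one-third-bound {n} {k} n≤3k with ≤-total n k
... | inj₁ n≤k rewrite m≤n⇒m∸n≡0 n≤k = z≤n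
... | inj₂ k≤n = subst (λ l → 2 * (n ∸ k) ^ 2 ≤ l ^ 2) (m+[n∸m]≡n k≤n)
                   (twice-square-≤ k (n ∸ k) (+-cancelˡ-≤ k _ _ k+[n∸k]≤3k))
  where
  k+[n∸k]≤3k : k + (n ∸ k) ≤ k + 2 * k
  k+[n∸k]≤3k = subst (_≤ 3 * k) (sym (m+[n∸m]≡n k≤n)) n≤3k

-- Monochromatic components of F_n ⊠ F_n

module _ {V : Set} (E : V → V → Set) (c : V → Fin k) where

  closed-neighbourhood-component : ∀ v {xs} → Unique xs → All (λ w → w ≡ v ⊎ E v w) xs →
                                   InMonoComponent E c v (filter (λ w → c w ≟ c v) xs)
  closed-neighbourhood-component v {xs} xs-unique near =
    Unique.filter⁺ (λ w → c w ≟ c v) xs-unique ,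
    All.map walk (All.zip (All.filter⁺ (λ w → c w ≟ c v) near , All.all-filter (λ w → c w ≟ c v) xs))
    where
    walk : ∀ {w} → (w ≡ v ⊎ E v w) × c w ≡ c v → MonoWalk E c v w
    walk (inj₁ refl , _)   = here
    walk (inj₂ vw , cw≡cv) = step vw (sym cw≡cv) here

module FanSquare (n : ℕ) (c : Fin (suc n) × Fin (suc n) → Fin 3) where

  Vertex : Set
  Vertex = Fin (suc n) × Fin (suc n)

  centre : Vertex
  centre = (zero , zero)

  axis₁ axis₂ : Fin n → Vertex
  axis₁ i = (suc i , zero)
  axis₂ j = (zero , suc j)

  cell : Fin n → Fin n → Vertex
  cell i j = (suc i , suc j)

  centre-adjacent : ∀ w → w ≡ centre ⊎ FanSq n centre w
  centre-adjacent (zero  , zero)  = inj₁ refl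
  centre-adjacent (zero  , suc _) = inj₂ (inj₁ (refl , tt))
  centre-adjacent (suc _ , zero)  = inj₂ (inj₂ (inj₁ (refl , tt)))
  centre-adjacent (suc _ , suc _) = inj₂ (inj₂ (inj₂ (tt , tt)))

  sameColour : (v : Vertex) → Decidable (λ w → c w ≡ c v)
  sameColour v w = c w ≟ c v

  Component : Vertex → List Vertex → Set
  Component = InMonoComponent (FanSq n) c

  neighbour-component : ∀ v (f : Fin n → Vertex) → (∀ {i j} → f i ≡ f j → i ≡ j) →
                        (∀ i → FanSq n v (f i)) → Component v (filter (sameColour v) (tabulate f))
  neighbour-component v f f-injective adjacent = closed-neighbourhood-component (FanSq n) c v
    (Unique.tabulate⁺ f-injective) (All.tabulate⁺ (inj₂ ∘ adjacent))

  centre-class : List Vertex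
  centre-class = filter (sameColour centre) (cartesianProduct (allFin (suc n)) (allFin (suc n)))

  centre-component : Component centre centre-class
  centre-component = closed-neighbourhood-component (FanSq n) c centre
    (Unique.cartesianProduct⁺ (Unique.allFin⁺ (suc n)) (Unique.allFin⁺ (suc n)))
    (All.universal centre-adjacent _)

  row-component : ∀ i → Component (axis₁ i) (filter (sameColour (axis₁ i)) (tabulate (cell i)))
  row-component i = neighbour-component (axis₁ i) (cell i) (λ { refl → refl }) (λ _ → inj₁ (refl , tt))

  column-component : ∀ j → Component (axis₂ j) (filter (sameColour (axis₂ j)) (tabulate (λ i → cell i j)))
  column-component j =
    neighbour-component (axis₂ j) (λ i → cell i j) (λ { refl → refl }) (λ _ → inj₂ (inj₁ (refl , tt)))

  axis₁-component : ∀ i → Component (axis₁ i) (filter (sameColour (axis₁ i)) (tabulate axis₂))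
  axis₁-component i = neighbour-component (axis₁ i) axis₂ (λ { refl → refl }) (λ _ → inj₂ (inj₂ (tt , tt)))

  axis₂-component : ∀ j → Component (axis₂ j) (filter (sameColour (axis₂ j)) (tabulate axis₁))
  axis₂-component j = neighbour-component (axis₂ j) axis₁ (λ { refl → refl }) (λ _ → inj₂ (inj₂ (tt , tt)))

  Small : ℕ → Set
  Small ℓ = 3 * ℓ < n

  module _ (1≤n : 1 ≤ n)
           (centre-small : Small (length centre-class))
           (row-small : ∀ i → Small (length (filter (sameColour (axis₁ i)) (tabulate (cell i)))))
           (column-small : ∀ j → Small (length (filter (sameColour (axis₂ j)) (tabulate (λ i → cell i j)))))
           (axis₁-small : ∀ i → Small (length (filter (sameColour (axis₁ i)) (tabulate axis₂))))
           (axis₂-small : ∀ j → Small (length (filter (sameColour (axis₂ j)) (tabulate axis₁))))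
           where

    a : Fin 3
    a = c centre

    #axis₁ #axis₂ #cells : ℕ
    #axis₁ = count (λ i → c (axis₁ i) ≟ a)
    #axis₂ = count (λ j → c (axis₂ j) ≟ a)
    #cells = ∑[ i < n ] count (λ j → c (cell i j) ≟ a)

    centre-class-size : length centre-class ≡ 𝟙 (a ≟ a) + #axis₂ + (#axis₁ + #cells)
    centre-class-size = trans (length-filter-cartesianProduct (sameColour centre) id id)
      (cong (𝟙 (a ≟ a) + #axis₂ +_)
            (∑-distrib-+ (λ i → 𝟙 (c (axis₁ i) ≟ a)) (λ i → count (λ j → c (cell i j) ≟ a))))

    centre-colour-small : Small (#axis₂ + (#axis₁ + #cells))
    centre-colour-small = ≤-<-trans
      (*-monoʳ-≤ 3 (≤-trans (+-monoˡ-≤ _ (m≤n+m #axis₂ (𝟙 (a ≟ a)))) (≤-reflexive (sym centre-class-size))))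
      centre-small

    small-count : {P : Pred Vertex p} (P? : Decidable P) (f : Fin n → Vertex) →
                  Small (length (filter P? (tabulate f))) → Small (count (P? ∘ f))
    small-count P? f = subst Small (length-filter-tabulate P? f)

    private-colour₁ : ∃[ i ] (c (axis₁ i) ≢ a × ∀ j → c (axis₂ j) ≢ c (axis₁ i))
    private-colour₁ = unshared-colour 1≤n (c ∘ axis₁) (c ∘ axis₂) a
      (≤-<-trans (*-monoʳ-≤ 3 (≤-trans (m≤m+n #axis₁ #cells) (m≤n+m _ #axis₂))) centre-colour-small)
      (λ j → small-count (sameColour (axis₂ j)) axis₁ (axis₂-small j))

    private-colour₂ : ∃[ j ] (c (axis₂ j) ≢ a × ∀ i → c (axis₁ i) ≢ c (axis₂ j))
    private-colour₂ = unshared-colour 1≤n (c ∘ axis₂) (c ∘ axis₁) a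
      (≤-<-trans (*-monoʳ-≤ 3 (m≤m+n #axis₂ _)) centre-colour-small)
      (λ i → small-count (sameColour (axis₁ i)) axis₂ (axis₁-small i))

    no-private-colours : ∀ {i₁ j₁} → c (axis₁ i₁) ≢ a → (∀ j → c (axis₂ j) ≢ c (axis₁ i₁)) →
                         c (axis₂ j₁) ≢ a → (∀ i → c (axis₁ i) ≢ c (axis₂ j₁)) → ⊥
    no-private-colours {i₁} {j₁} b≢a b-private d≢a d-private =
      grid-not-covered ρ κ σ cover
        (λ i → small-count (sameColour (axis₁ i)) (cell i) (row-small i))
        (λ j → small-count (sameColour (axis₂ j)) (λ i → cell i j) (column-small j))
        (subst (λ t → 3 * t < n * n) (sym ∑∑σ) (weighted-sum-< #cells #axis₁ #axis₂ 1≤n centre-colour-small))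
      where
      b d : Fin 3
      b = c (axis₁ i₁)
      d = c (axis₂ j₁)

      a-b-d : ∀ w → w ≡ a ⊎ w ≡ b ⊎ w ≡ d
      a-b-d w = three-colours a b d w (≢-sym b≢a) (≢-sym (b-private j₁)) (≢-sym d≢a)

      axis₁-colour : ∀ i → c (axis₁ i) ≡ a ⊎ c (axis₁ i) ≡ b
      axis₁-colour i with a-b-d (c (axis₁ i))
      ... | inj₁ e        = inj₁ e
      ... | inj₂ (inj₁ e) = inj₂ e
      ... | inj₂ (inj₂ e) = ⊥-elim (d-private i e)

      axis₂-colour : ∀ j → c (axis₂ j) ≡ a ⊎ c (axis₂ j) ≡ d
      axis₂-colour j with a-b-d (c (axis₂ j))
      ... | inj₁ e        = inj₁ e
      ... | inj₂ (inj₁ e) = ⊥-elim (b-private j e)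
      ... | inj₂ (inj₂ e) = inj₂ e

      cell-colour : ∀ i j → c (cell i j) ≡ c (axis₁ i) ⊎ c (cell i j) ≡ c (axis₂ j) ⊎
                            (c (cell i j) ≡ a ⊎ c (axis₁ i) ≡ a ⊎ c (axis₂ j) ≡ a)
      cell-colour i j with a-b-d (c (cell i j)) | axis₁-colour i | axis₂-colour j
      ... | inj₁ e        | _       | _       = inj₂ (inj₂ (inj₁ e))
      ... | inj₂ (inj₁ e) | inj₁ e₁ | _       = inj₂ (inj₂ (inj₂ (inj₁ e₁)))
      ... | inj₂ (inj₁ e) | inj₂ e₁ | _       = inj₁ (trans e (sym e₁))
      ... | inj₂ (inj₂ e) | _       | inj₁ e₂ = inj₂ (inj₂ (inj₂ (inj₂ e₂)))
      ... | inj₂ (inj₂ e) | _       | inj₂ e₂ = inj₂ (inj₁ (trans e (sym e₂)))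

      ρ κ σ : Fin n → Fin n → ℕ
      ρ i j = 𝟙 (c (cell i j) ≟ c (axis₁ i))
      κ i j = 𝟙 (c (cell i j) ≟ c (axis₂ j))
      σ i j = 𝟙 (c (cell i j) ≟ a) + 𝟙 (c (axis₁ i) ≟ a) + 𝟙 (c (axis₂ j) ≟ a)

      cover : ∀ i j → 1 ≤ ρ i j + κ i j + σ i j
      cover i j = pos-+₃ (Sum.map (P⇒1≤𝟙 (c (cell i j) ≟ c (axis₁ i)))
                           (Sum.map (P⇒1≤𝟙 (c (cell i j) ≟ c (axis₂ j))) (pos-+₃ ∘ centre-coloured))
                           (cell-colour i j))
        where
        centre-coloured : c (cell i j) ≡ a ⊎ c (axis₁ i) ≡ a ⊎ c (axis₂ j) ≡ a →
                          1 ≤ 𝟙 (c (cell i j) ≟ a) ⊎ 1 ≤ 𝟙 (c (axis₁ i) ≟ a) ⊎ 1 ≤ 𝟙 (c (axis₂ j) ≟ a)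
        centre-coloured = Sum.map (P⇒1≤𝟙 (c (cell i j) ≟ a))
                            (Sum.map (P⇒1≤𝟙 (c (axis₁ i) ≟ a)) (P⇒1≤𝟙 (c (axis₂ j) ≟ a)))

      ∑∑σ : ∑[ i < n ] ∑[ j < n ] σ i j ≡ #cells + n * #axis₁ + n * #axis₂
      ∑∑σ = begin
        ∑[ i < n ] ∑[ j < n ] σ i j
          ≡⟨ ∑₂-distrib-+ (λ i j → 𝟙 (c (cell i j) ≟ a) + 𝟙 (c (axis₁ i) ≟ a)) (λ _ j → 𝟙 (c (axis₂ j) ≟ a)) ⟩
        ∑[ i < n ] ∑[ j < n ] (𝟙 (c (cell i j) ≟ a) + 𝟙 (c (axis₁ i) ≟ a)) + ∑[ i < n ] #axis₂
          ≡⟨ cong₂ _+_ (∑₂-distrib-+ (λ i j → 𝟙 (c (cell i j) ≟ a)) (λ i _ → 𝟙 (c (axis₁ i) ≟ a)))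
                       (∑-const n #axis₂) ⟩
        #cells + ∑[ i < n ] ∑[ j < n ] 𝟙 (c (axis₁ i) ≟ a) + n * #axis₂
          ≡⟨ cong (λ t → #cells + t + n * #axis₂)
               (trans (sum-cong-≗ {n} (λ i → ∑-const n _)) (sym (*-distribˡ-sum n (λ i → 𝟙 (c (axis₁ i) ≟ a))))) ⟩
        #cells + n * #axis₁ + n * #axis₂ ∎
        where open ≡-Reasoning

    small-components-impossible : ⊥
    small-components-impossible with private-colour₁ | private-colour₂
    ... | _ , b≢a , b-private | _ , d≢a , d-private = no-private-colours b≢a b-private d≢a d-private

  LargeComponent : Set
  LargeComponent = ∃[ v ] ∃[ L ] (Component v L × n ≤ 3 * length L)

  large-or-small : ∀ {v L} → Component v L → LargeComponent ⊎ Small (length L)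
  large-or-small {v} {L} component with n ≤? 3 * length L
  ... | yes large = inj₁ (v , L , component , large)
  ... | no ¬large = inj₂ (≰⇒> ¬large)

  large-component : 1 ≤ n → LargeComponent
  large-component 1≤n
    with large-or-small centre-component
       | ∀-⊎ (large-or-small ∘ row-component)   | ∀-⊎ (large-or-small ∘ column-component)
       | ∀-⊎ (large-or-small ∘ axis₁-component) | ∀-⊎ (large-or-small ∘ axis₂-component)
  ... | inj₁ large | _          | _          | _          | _          = large
  ... | _          | inj₁ large | _          | _          | _          = large
  ... | _          | _          | inj₁ large | _          | _          = large
  ... | _          | _          | _          | inj₁ large | _          = large
  ... | _          | _          | _          | _          | inj₁ large = large
  ... | inj₂ s₀    | inj₂ s-row | inj₂ s-col | inj₂ s₁    | inj₂ s₂    =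
    ⊥-elim (small-components-impossible 1≤n s₀ s-row s-col s₁ s₂)

lemma18 : (n : ℕ) → 1 ≤ n → (c : Fin (suc n) × Fin (suc n) → Fin 3) →
    ∃[ v ] ∃[ L ] (InMonoComponent (FanSq n) c v L × 2 * (n ∸ length L) ^ 2 ≤ n ^ 2)
lemma18 n 1≤n c with FanSquare.large-component n c 1≤n
... | v , L , component , large = v , L , component , one-third-bound {k = length L} large
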